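{- For any $X\subseteq[n]$ with $|X|\leq n-3$, there is a point $x\in\{0,1/2,1\}^{\{P_{i,j}:i\neq j\in[n]\}}$ satisfying all inequalities of $\mathrm{LOP}_n$ such that $x(P_{i,j})\in\{0,1\}$ for every variable $P_{i,j}$ with $\{i,j\}\cap X\neq\emptyset$.
   Context: $\mathrm{LOP}_n$ is the set of integer linear inequalities over variables $P_{i,j}$ ($i\neq j\in[n]$): $P_{i,j}+P_{j,i}=1$ for all $i\neq j$; $P_{i,k}-P_{i,j}-P_{j,k}\geq -1$ for all pairwise distinct $i,j,k\in[n]$; and $\sum_{i\in[n],\,i\neq j}P_{i,j}\geq 1$ for all $j\in[n]$. -}

module Defs where

open import Data.Nat using (ℕ; zero; suc)
open import Data.Fin using (Fin; zero; suc; _≟_)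
open import Data.Rational using (ℚ; 0ℚ; 1ℚ; ½; _+_; _-_; _≤_; -_)
open import Relation.Binary.PropositionalEquality using (_≡_; _≢_)
open import Relation.Nullary using (yes; no)
open import Data.Sum using (_⊎_)
open import Data.Product using (_×_)

sumFin : {n : ℕ} → (Fin n → ℚ) → ℚ
sumFin {zero} f = 0ℚ
sumFin {suc n} f = f zero + sumFin {n} (λ i → f (suc i))

-- An assignment to the variables P_{i,j}; the diagonal values x i i are unused.
Assignment : ℕ → Set
Assignment n = Fin n → Fin n → ℚ

colSum : {n : ℕ} → Assignment n → Fin n → ℚ
colSum x j = sumFin (λ i → summand i)
  where
  summand : _ → ℚ
  summand i with i ≟ j
  ... | yes _ = 0ℚ
  ... | no  _ = x i j

SatisfiesLOP : (n : ℕ) → Assignment n → Set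
SatisfiesLOP n x =
  ((i j : Fin n) → i ≢ j → x i j + x j i ≡ 1ℚ)
  × ((i j k : Fin n) → i ≢ j → j ≢ k → i ≢ k → - 1ℚ ≤ (x i k - x i j) - x j k)
  × ((j : Fin n) → 1ℚ ≤ colSum x j)

HalfIntegral : ℚ → Set
HalfIntegral q = q ≡ 0ℚ ⊎ q ≡ ½ ⊎ q ≡ 1ℚ

Integral01 : ℚ → Set
Integral01 q = q ≡ 0ℚ ⊎ q ≡ 1ℚ

-- Rank the elements so that those outside X all tie at the bottom while those of X are
-- pairwise distinct above them, and set x(P_{i,j}) to the probability that i precedes j once
-- ties are broken uniformly at random. Each realisation of the tie-breaking is a linear
-- order, so x is a convex combination of linear orders and satisfies the equations and
-- triangle inequalities; pairs meeting X are never tied, hence get 0 or 1. A column j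
-- receives ½ from each of at least n - |X| - 1 ≥ 2 bottom elements other than j.
module Submission where

open import Defs
open import Data.Nat using (ℕ; zero; suc; _+_; _≤_; _<_; z≤n; s≤s)
import Data.Nat.Properties as ℕ
open import Data.Fin using (Fin; toℕ; _≟_) renaming (zero to fzero; suc to fsuc)
open import Data.Fin.Properties using (toℕ-injective)
open import Data.Fin.Subset
  using (Subset; _∈_; _∉_; ∣_∣; ∁; Nonempty; inside; outside) renaming (_-_ to _∖_)
open import Data.Fin.Subset.Properties
  using (_∈?_; nonempty?; Empty-unique; ∣⊥∣≡0; ∣∁p∣≡n∸∣p∣; x∈∁p⇒x∉p; p─q⊆p; p─⊥≡p)
open import Data.Vec using (_∷_; there)
open import Data.Rational using (ℚ; 0ℚ; 1ℚ; ½; -_; _-_) renaming (_+_ to _+ℚ_; _≤_ to _≤ℚ_)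
import Data.Rational.Properties as ℚ
open import Data.Product using (Σ; _×_; _,_; ∃₂)
open import Data.Sum using (_⊎_; inj₁; inj₂)
open import Function using (_∘_)
open import Relation.Nullary using (yes; no; contradiction)
open import Relation.Nullary.Decidable using (True; toWitness)
open import Relation.Binary.PropositionalEquality
  using (_≡_; _≢_; refl; sym; trans; cong; subst; subst₂)

decide-≤ : (p q : ℚ) → {True (p ℚ.≤? q)} → p ≤ℚ q
decide-≤ p q {p≤q} = toWitness p≤q

minus-mono-≤ : {p q r s : ℚ} → p ≤ℚ q → r ≤ℚ s → p - s ≤ℚ q - r
minus-mono-≤ p≤q r≤s = ℚ.+-mono-≤ p≤q (ℚ.neg-antimono-≤ r≤s)

sumFin-nonneg : {n : ℕ} (f : Fin n → ℚ) → (∀ i → 0ℚ ≤ℚ f i) → 0ℚ ≤ℚ sumFin f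
sumFin-nonneg {zero}  f f≥0 = ℚ.≤-refl
sumFin-nonneg {suc n} f f≥0 =
  ℚ.+-mono-≤ (f≥0 fzero) (sumFin-nonneg (f ∘ fsuc) (f≥0 ∘ fsuc))

sumFin-≥-term : {n : ℕ} (f : Fin n → ℚ) → (∀ i → 0ℚ ≤ℚ f i) → ∀ a → f a ≤ℚ sumFin f
sumFin-≥-term f f≥0 fzero =
  subst (_≤ℚ sumFin f) (ℚ.+-identityʳ (f fzero))
    (ℚ.+-monoʳ-≤ (f fzero) (sumFin-nonneg (f ∘ fsuc) (f≥0 ∘ fsuc)))
sumFin-≥-term f f≥0 (fsuc a) =
  subst (_≤ℚ sumFin f) (ℚ.+-identityˡ (f (fsuc a)))
    (ℚ.+-mono-≤ (f≥0 fzero) (sumFin-≥-term (f ∘ fsuc) (f≥0 ∘ fsuc) a))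

sumFin-≥-pair : {n : ℕ} (f : Fin n → ℚ) → (∀ i → 0ℚ ≤ℚ f i) →
                {a b : Fin n} → a ≢ b → f a +ℚ f b ≤ℚ sumFin f
sumFin-≥-pair f f≥0 {fzero} {fzero} a≢b = contradiction refl a≢b
sumFin-≥-pair f f≥0 {fzero} {fsuc b} _ =
  ℚ.+-monoʳ-≤ (f fzero) (sumFin-≥-term (f ∘ fsuc) (f≥0 ∘ fsuc) b)
sumFin-≥-pair f f≥0 {fsuc a} {fzero} _ =
  subst (_≤ℚ sumFin f) (ℚ.+-comm (f fzero) (f (fsuc a)))
    (ℚ.+-monoʳ-≤ (f fzero) (sumFin-≥-term (f ∘ fsuc) (f≥0 ∘ fsuc) a))
sumFin-≥-pair f f≥0 {fsuc a} {fsuc b} a≢b =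
  subst (_≤ℚ sumFin f) (ℚ.+-identityˡ _)
    (ℚ.+-mono-≤ (f≥0 fzero) (sumFin-≥-pair (f ∘ fsuc) (f≥0 ∘ fsuc) (a≢b ∘ cong fsuc)))

-- The summand of colSum is local to Defs; unifying colSum x j with sumFin f recovers it.
summandsOf : {n : ℕ} {f : Fin n → ℚ} {s : ℚ} → s ≡ sumFin f → Fin n → ℚ
summandsOf {f = f} _ = f

colTerm : {n : ℕ} → Assignment n → Fin n → Fin n → ℚ
colTerm x j = summandsOf {s = colSum x j} refl

colTerm-offDiagonal : {n : ℕ} (x : Assignment n) {i j : Fin n} → i ≢ j → colTerm x j i ≡ x i j
colTerm-offDiagonal x {i} {j} i≢j with i ≟ j
... | yes i≡j = contradiction i≡j i≢j
... | no  _   = refl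

colSum-≥-pair : {n : ℕ} (x : Assignment n) (j : Fin n) → (∀ i → i ≢ j → 0ℚ ≤ℚ x i j) →
                {a b : Fin n} → a ≢ b → a ≢ j → b ≢ j → x a j +ℚ x b j ≤ℚ colSum x j
colSum-≥-pair x j x≥0 a≢b a≢j b≢j =
  subst₂ (λ u v → u +ℚ v ≤ℚ colSum x j) (colTerm-offDiagonal x a≢j) (colTerm-offDiagonal x b≢j)
    (sumFin-≥-pair (colTerm x j) colTerm≥0 a≢b)
  where
  colTerm≥0 : ∀ i → 0ℚ ≤ℚ colTerm x j i
  colTerm≥0 i with i ≟ j
  ... | yes _   = ℚ.≤-refl
  ... | no  i≢j = x≥0 i i≢j

precedence : ℕ → ℕ → ℚ
precedence zero    zero    = ½
precedence zero    (suc _) = 1ℚ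
precedence (suc _) zero    = 0ℚ
precedence (suc m) (suc n) = precedence m n

precedence-halfIntegral : ∀ m n → HalfIntegral (precedence m n)
precedence-halfIntegral zero    zero    = inj₂ (inj₁ refl)
precedence-halfIntegral zero    (suc _) = inj₂ (inj₂ refl)
precedence-halfIntegral (suc _) zero    = inj₁ refl
precedence-halfIntegral (suc m) (suc n) = precedence-halfIntegral m n

precedence-integral : ∀ {m n} → m ≢ n → Integral01 (precedence m n)
precedence-integral {zero}  {zero}  m≢n = contradiction refl m≢n
precedence-integral {zero}  {suc _} _   = inj₂ refl
precedence-integral {suc _} {zero}  _   = inj₁ refl
precedence-integral {suc m} {suc n} m≢n = precedence-integral (m≢n ∘ cong suc)

precedence-complement : ∀ m n → precedence m n +ℚ precedence n m ≡ 1ℚ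
precedence-complement zero    zero    = refl
precedence-complement zero    (suc _) = refl
precedence-complement (suc _) zero    = refl
precedence-complement (suc m) (suc n) = precedence-complement m n

0≤precedence : ∀ m n → 0ℚ ≤ℚ precedence m n
0≤precedence zero    zero    = decide-≤ 0ℚ ½
0≤precedence zero    (suc _) = decide-≤ 0ℚ 1ℚ
0≤precedence (suc _) zero    = ℚ.≤-refl
0≤precedence (suc m) (suc n) = 0≤precedence m n

precedence≤1 : ∀ m n → precedence m n ≤ℚ 1ℚ
precedence≤1 zero    zero    = decide-≤ ½ 1ℚ
precedence≤1 zero    (suc _) = ℚ.≤-refl
precedence≤1 (suc _) zero    = decide-≤ 0ℚ 1ℚ
precedence≤1 (suc m) (suc n) = precedence≤1 m n

½≤precedence : ∀ {m n} → m ≤ n → ½ ≤ℚ precedence m n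
½≤precedence {n = zero}  z≤n       = ℚ.≤-refl
½≤precedence {n = suc _} z≤n       = decide-≤ ½ 1ℚ
½≤precedence             (s≤s m≤n) = ½≤precedence m≤n

precedence-transitive : ∀ a b c →
  - 1ℚ ≤ℚ (precedence a c - precedence a b) - precedence b c
precedence-transitive zero    zero    zero    = decide-≤ _ _
precedence-transitive zero    zero    (suc _) = decide-≤ _ _
precedence-transitive zero    (suc _) zero    = decide-≤ _ _
precedence-transitive zero    (suc b) (suc c) =
  minus-mono-≤ (ℚ.≤-refl {1ℚ - 1ℚ}) (precedence≤1 b c)
precedence-transitive (suc a) zero    c       =
  minus-mono-≤ (minus-mono-≤ (0≤precedence (suc a) c) (ℚ.≤-refl {0ℚ})) (precedence≤1 zero c)
precedence-transitive (suc a) (suc b) zero    =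
  minus-mono-≤ (minus-mono-≤ (ℚ.≤-refl {0ℚ}) (precedence≤1 a b)) (ℚ.≤-refl {0ℚ})
precedence-transitive (suc a) (suc b) (suc c) = precedence-transitive a b c

weakOrderPoint : {n : ℕ} → (Fin n → ℕ) → Assignment n
weakOrderPoint r i j = precedence (r i) (r j)

weakOrderPoint-satisfiesLOP : {n : ℕ} (r : Fin n → ℕ) →
  (∀ j → ∃₂ λ a b → a ≢ b × a ≢ j × b ≢ j × r a ≤ r j × r b ≤ r j) →
  SatisfiesLOP n (weakOrderPoint r)
weakOrderPoint-satisfiesLOP {n} r twoBelow =
  (λ i j _ → precedence-complement (r i) (r j)) ,
  (λ i j k _ _ _ → precedence-transitive (r i) (r j) (r k)) ,
  column
  where
  column : (j : Fin n) → 1ℚ ≤ℚ colSum (weakOrderPoint r) j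
  column j =
    let a , b , a≢b , a≢j , b≢j , ra≤rj , rb≤rj = twoBelow j
    in ℚ.≤-trans (ℚ.+-mono-≤ (½≤precedence ra≤rj) (½≤precedence rb≤rj))
         (colSum-≥-pair (weakOrderPoint r) j (λ i _ → 0≤precedence (r i) (r j)) a≢b a≢j b≢j)

∣p∣≤1+∣p∖x∣ : {n : ℕ} (p : Subset n) (x : Fin n) → ∣ p ∣ ≤ suc ∣ p ∖ x ∣
∣p∣≤1+∣p∖x∣ (inside  ∷ p) fzero    = s≤s (ℕ.≤-reflexive (cong ∣_∣ (sym (p─⊥≡p p))))
∣p∣≤1+∣p∖x∣ (outside ∷ p) fzero    = ℕ.m≤n⇒m≤1+n (ℕ.≤-reflexive (cong ∣_∣ (sym (p─⊥≡p p))))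
∣p∣≤1+∣p∖x∣ (inside  ∷ p) (fsuc x) = s≤s (∣p∣≤1+∣p∖x∣ p x)
∣p∣≤1+∣p∖x∣ (outside ∷ p) (fsuc x) = ∣p∣≤1+∣p∖x∣ p x

0<∣p∣⇒Nonempty : {n : ℕ} (p : Subset n) → 0 < ∣ p ∣ → Nonempty p
0<∣p∣⇒Nonempty {n} p 0<∣p∣ with nonempty? p
... | yes p≠∅ = p≠∅
... | no  p=∅ = contradiction (subst (0 <_) ∣p∣≡0 0<∣p∣) (ℕ.<-irrefl refl)
  where
  ∣p∣≡0 : ∣ p ∣ ≡ 0
  ∣p∣≡0 = trans (cong ∣_∣ (Empty-unique p=∅)) (∣⊥∣≡0 n)

x∈p∖y⇒x≢y : {n : ℕ} {p : Subset n} {x y : Fin n} → x ∈ p ∖ y → x ≢ y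
x∈p∖y⇒x≢y {p = _ ∷ _} {fzero}  ()          refl
x∈p∖y⇒x≢y {p = _ ∷ _} {fsuc x} (there x∈p) refl = x∈p∖y⇒x≢y x∈p refl

∃-pair-avoiding : {n : ℕ} (p : Subset n) → 3 ≤ ∣ p ∣ → (y : Fin n) →
  ∃₂ λ a b → a ∈ p × b ∈ p × a ≢ b × a ≢ y × b ≢ y
∃-pair-avoiding p 3≤∣p∣ y =
  let 2≤∣p∖y∣ = ℕ.≤-pred (ℕ.≤-trans 3≤∣p∣ (∣p∣≤1+∣p∖x∣ p y))
      a , a∈p∖y = 0<∣p∣⇒Nonempty (p ∖ y) (ℕ.≤-trans (s≤s z≤n) 2≤∣p∖y∣)
      b , b∈p∖y∖a = 0<∣p∣⇒Nonempty (p ∖ y ∖ a)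
                      (ℕ.≤-pred (ℕ.≤-trans 2≤∣p∖y∣ (∣p∣≤1+∣p∖x∣ (p ∖ y) a)))
      b∈p∖y = p─q⊆p _ _ b∈p∖y∖a
  in a , b , p─q⊆p _ _ a∈p∖y , p─q⊆p _ _ b∈p∖y ,
     (λ a≡b → x∈p∖y⇒x≢y b∈p∖y∖a (sym a≡b)) , x∈p∖y⇒x≢y a∈p∖y , x∈p∖y⇒x≢y b∈p∖y

rank : {n : ℕ} → Subset n → Fin n → ℕ
rank X i with i ∈? X
... | yes _ = suc (toℕ i)
... | no  _ = zero

rank-∉ : {n : ℕ} {X : Subset n} {i : Fin n} → i ∉ X → rank X i ≡ 0
rank-∉ {X = X} {i} i∉X with i ∈? X
... | yes i∈X = contradiction i∈X i∉X
... | no  _   = refl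

rank-injectiveˡ : {n : ℕ} {X : Subset n} {i j : Fin n} → i ∈ X → rank X i ≡ rank X j → i ≡ j
rank-injectiveˡ {X = X} {i} {j} i∈X ri≡rj with i ∈? X | j ∈? X
... | no  i∉X | _     = contradiction i∈X i∉X
... | yes _   | yes _ = toℕ-injective (ℕ.suc-injective ri≡rj)
... | yes _   | no  _ = contradiction ri≡rj λ ()

mainTheorem18 : (n : ℕ) (X : Subset n) → ∣ X ∣ + 3 ≤ n →
    Σ (Assignment n) (λ x →
    ((i j : Fin n) → i ≢ j → HalfIntegral (x i j))
    × SatisfiesLOP n x
    × ((i j : Fin n) → i ≢ j → (i ∈ X ⊎ j ∈ X) → Integral01 (x i j)))
mainTheorem18 n X ∣X∣+3≤n =
  weakOrderPoint (rank X) ,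
  (λ i j _ → precedence-halfIntegral (rank X i) (rank X j)) ,
  weakOrderPoint-satisfiesLOP (rank X) twoBelow ,
  integral
  where
  3≤∣∁X∣ : 3 ≤ ∣ ∁ X ∣
  3≤∣∁X∣ = subst₂ _≤_ (ℕ.m+n∸m≡n ∣ X ∣ 3) (sym (∣∁p∣≡n∸∣p∣ X)) (ℕ.∸-monoˡ-≤ ∣ X ∣ ∣X∣+3≤n)

  twoBelow : ∀ j → ∃₂ λ a b → a ≢ b × a ≢ j × b ≢ j × rank X a ≤ rank X j × rank X b ≤ rank X j
  twoBelow j =
    let a , b , a∈∁X , b∈∁X , a≢b , a≢j , b≢j = ∃-pair-avoiding (∁ X) 3≤∣∁X∣ j
        bottom : ∀ {i} → i ∈ ∁ X → rank X i ≤ rank X j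
        bottom i∈∁X = subst (_≤ rank X j) (sym (rank-∉ (x∈∁p⇒x∉p i∈∁X))) z≤n
    in a , b , a≢b , a≢j , b≢j , bottom a∈∁X , bottom b∈∁X

  integral : (i j : Fin n) → i ≢ j → i ∈ X ⊎ j ∈ X → Integral01 (weakOrderPoint (rank X) i j)
  integral i j i≢j (inj₁ i∈X) = precedence-integral (i≢j ∘ rank-injectiveˡ i∈X)
  integral i j i≢j (inj₂ j∈X) = precedence-integral (i≢j ∘ sym ∘ rank-injectiveˡ j∈X ∘ sym)
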